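{- Let $Q,R,S\in\mathfrak{P}$ with $Q\cap R=\emptyset$, $Q\cap S=\emptyset$; let $Y$ be the carrier of $Q$ and $X$ the carrier of $R$. Let $\epsilon:\mathcal{E}(Q\oplus R)\to\mathcal{E}(Q\oplus S)$ be an injective homomorphism (with respect to $\le_+$) such that for every $P\in\mathfrak{P}_r$, $\xi\in\mathcal{H}(P,Q\oplus R)$ and $x\in P$ we have $\alpha_{P,\eta(\xi)}(x)=\epsilon(\alpha_{P,\xi}(x))$, where $\eta(\xi):P\to Q\oplus S$ is defined by $\eta(\xi)(z):=\epsilon(\alpha_{P,\xi}(z))_1$. Put $\mathcal{E}(Q)^*:=\{(y,D,U\cup X):(y,D,U)\in\mathcal{E}(Q)\}\subseteq\mathcal{E}(Q\oplus R)$, and define $r:\mathcal{E}(R)\to\mathcal{E}(Q\oplus R)$, $r(x,D,U):=(x,D\cup Y,U)$, and $s(x,D,U):=(x,D\setminus Y,U)$ for $(x,D,U)\in\mathcal{E}(Q\oplus S)$. Assume $Y\subseteq\{\epsilon(\mathfrak a)_1:\mathfrak a\in\mathcal{E}(Q)^*\}$. Then $R\sqsubseteq_I S$. More precisely, $T:=s\circ\epsilon\circ r$ is an injective homomorphism $\mathcal{E}(R)\to\mathcal{E}(S)$, and for all $P\in\mathfrak{P}_r$, $\xi\in\mathcal{H}(P,R)$, $x\in P$ we have $\alpha_{P,\tau_P(\xi)}(x)=T(\alpha_{P,\xi}(x))$, where $\tau_P(\xi)(z):=T(\alpha_{P,\xi}(z))_1$ for $z\in P$.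
   Context: $\mathfrak{P}$ is the class of finite nonempty posets and $\mathfrak{P}_r$ a fixed system of representatives of its isomorphism classes. $\mathcal{H}(P,Q)$ is the set of order-preserving maps $P\to Q$. $A\oplus B$ is the ordinal sum of disjoint posets (every element of $A$ below every element of $B$). For $A\subseteq P$, $x\in A$: $\gamma_A(x)$ is the set of $y\in A$ joined to $x$ by a sequence $x=z_0,\dots,z_L=y$ in $A$ ($L\ge0$) with consecutive elements strictly comparable; for a map $\xi$ on $P$, $G_\xi(x):=\gamma_{\xi^{ -1}(\xi(x))}(x)$. For $A\subseteq P$, ${\downarrow^{\circ}}A:=\{y: y\le a\text{ for some }a\in A\}\setminus A$, ${\uparrow_{\circ}}A:=\{y: y\ge a\text{ for some }a\in A\}\setminus A$. The EV-system $\mathcal{E}(P)$ is the set of triples $(x,D,U)$ with $x\in P$, $D\subseteq{\downarrow^{\circ}}\{x\}$, $U\subseteq{\uparrow_{\circ}}\{x\}$; $\mathfrak a<_+\mathfrak b$ iff $\mathfrak a_1\in\mathfrak b_2$ and $\mathfrak b_1\in\mathfrak a_3$; $\le_+$ is $<_+$ plus equality; a homomorphism $f$ between EV-systems satisfies $\mathfrak a\le_+\mathfrak b\Rightarrow f(\mathfrak a)\le_+ f(\mathfrak b)$. For $\xi\in\mathcal{H}(P,Q)$, $\alpha_{P,\xi}(x):=(\xi(x),\xi({\downarrow^{\circ}}G_\xi(x)),\xi({\uparrow_{\circ}}G_\xi(x)))$. A Hom-scheme from $R$ to $S$ is a family $(\rho_P)_{P\in\mathfrak{P}_r}$ of maps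 $\rho_P:\mathcal{H}(P,R)\to\mathcal{H}(P,S)$; strong if each $\rho_P$ is injective; an I-scheme if for all $P,P'\in\mathfrak{P}_r$, $\xi\in\mathcal{H}(P,R)$, $\zeta\in\mathcal{H}(P',R)$, $x\in P$, $y\in P'$: $\alpha_{P,\xi}(x)\le_+\alpha_{P',\zeta}(y)$ implies $\alpha_{P,\rho_P(\xi)}(x)\le_+\alpha_{P',\rho_{P'}(\zeta)}(y)$, with $<_+$ preserved. $R\sqsubseteq_I S$ means a strong I-scheme from $R$ to $S$ exists. -}

module Defs where

open import Data.Nat using (ℕ)
open import Data.Fin using (Fin)
open import Data.Sum using (_⊎_; inj₁; inj₂)
open import Data.Product using (Σ; ∃; _×_; _,_; proj₁; proj₂)
open import Data.Empty using (⊥-elim)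
open import Relation.Nullary using (¬_)
open import Relation.Binary.PropositionalEquality
  using (_≡_; refl; sym; trans; cong; subst; isEquivalence)
open import Relation.Binary.Structures using (IsPartialOrder; IsPreorder)
open import Function.Bundles using (_↔_; _⇔_)

record Pos : Set₁ where
  field
    Carrier        : Set
    _≤_            : Carrier → Carrier → Set
    isPartialOrder : IsPartialOrder _≡_ _≤_

C : Pos → Set
C = Pos.Carrier

Le : (P : Pos) → C P → C P → Set
Le = Pos._≤_

Lt : (P : Pos) → C P → C P → Set
Lt P x y = Le P x y × ¬ (x ≡ y)

-- finite nonempty posets (the class 𝔓)
record FinPoset : Set₁ where
  field
    pos        : Pos
    size       : ℕ
    finite     : Pos.Carrier pos ↔ Fin size
    inhabitant : Pos.Carrier pos

poset : FinPoset → Pos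
poset = FinPoset.pos

-- Ordinal sum A ⊕ B (disjointness realised by a disjoint union)

data SumLe (A B : Pos) : C A ⊎ C B → C A ⊎ C B → Set where
  ₁≤₁ : ∀ {a a'} → Le A a a' → SumLe A B (inj₁ a) (inj₁ a')
  ₁≤₂ : ∀ {a b} → SumLe A B (inj₁ a) (inj₂ b)
  ₂≤₂ : ∀ {b b'} → Le B b b' → SumLe A B (inj₂ b) (inj₂ b')

module _ (A B : Pos) where
  private
    module A = IsPartialOrder (Pos.isPartialOrder A)
    module B = IsPartialOrder (Pos.isPartialOrder B)

  sumLe-refl : ∀ {x y} → x ≡ y → SumLe A B x y
  sumLe-refl {inj₁ a} refl = ₁≤₁ (A.reflexive refl)
  sumLe-refl {inj₂ b} refl = ₂≤₂ (B.reflexive refl)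

  sumLe-trans : ∀ {x y z} → SumLe A B x y → SumLe A B y z → SumLe A B x z
  sumLe-trans (₁≤₁ p) (₁≤₁ q) = ₁≤₁ (A.trans p q)
  sumLe-trans (₁≤₁ p) ₁≤₂ = ₁≤₂
  sumLe-trans ₁≤₂ (₂≤₂ q) = ₁≤₂
  sumLe-trans (₂≤₂ p) (₂≤₂ q) = ₂≤₂ (B.trans p q)

  sumLe-antisym : ∀ {x y} → SumLe A B x y → SumLe A B y x → x ≡ y
  sumLe-antisym (₁≤₁ p) (₁≤₁ q) = cong inj₁ (A.antisym p q)
  sumLe-antisym (₂≤₂ p) (₂≤₂ q) = cong inj₂ (B.antisym p q)

_⊕_ : Pos → Pos → Pos
A ⊕ B = record
  { Carrier = C A ⊎ C B
  ; _≤_ = SumLe A B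
  ; isPartialOrder = record
      { isPreorder = record
          { isEquivalence = isEquivalence
          ; reflexive = sumLe-refl A B
          ; trans = sumLe-trans A B
          }
      ; antisym = sumLe-antisym A B
      }
  }

Sub : Pos → Set₁
Sub P = C P → Set

Down : (P : Pos) → Sub P → Sub P
Down P A y = (∃ λ a → A a × Le P y a) × ¬ A y

Up : (P : Pos) → Sub P → Sub P
Up P A y = (∃ λ a → A a × Le P a y) × ¬ A y

sing : {P : Pos} → C P → Sub P
sing x z = z ≡ x

img : {X Y : Set} → (X → Y) → (X → Set) → Y → Set
img f A q = ∃ λ y → A y × f y ≡ q

data Chain (P : Pos) (A : Sub P) (x : C P) : C P → Set where
  here : A x → Chain P A x x
  step : ∀ {y z} → Chain P A x y → A z → (Lt P y z ⊎ Lt P z y) → Chain P A x z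

γ : (P : Pos) → Sub P → C P → Sub P
γ P A x = Chain P A x

G : (P : Pos) {B : Set} → (C P → B) → C P → Sub P
G P ξ x = γ P (λ z → ξ z ≡ ξ x) x

chain-end : ∀ {P A x y} → Chain P A x y → A y
chain-end (here a) = a
chain-end (step _ a _) = a

record Triple (P : Pos) : Set₁ where
  constructor ⟨_,_,_⟩
  field
    pt : C P
    dn : Sub P
    up : Sub P
open Triple public

IsEV : (P : Pos) → Triple P → Set
IsEV P t = (∀ y → dn t y → Down P (sing {P} (pt t)) y)
         × (∀ y → up t y → Up P (sing {P} (pt t)) y)

record EV (P : Pos) : Set₁ where
  constructor ev
  field
    tr   : Triple P
    isEV : IsEV P tr
open EV public

-- equality of triples (sets compared extensionally)
_≈T_ : {P : Pos} → Triple P → Triple P → Set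
s ≈T t = (pt s ≡ pt t) × (∀ z → dn s z ⇔ dn t z) × (∀ z → up s z ⇔ up t z)

_≈E_ : {P : Pos} → EV P → EV P → Set
a ≈E b = tr a ≈T tr b

fstE : {P : Pos} → EV P → C P
fstE a = pt (tr a)

_<+_ : {P : Pos} → EV P → EV P → Set
a <+ b = dn (tr b) (fstE a) × up (tr a) (fstE b)

_≤+_ : {P : Pos} → EV P → EV P → Set
a ≤+ b = (a <+ b) ⊎ (a ≈E b)

Monotone : (P Q : Pos) → (C P → C Q) → Set
Monotone P Q f = ∀ {x y} → Le P x y → Le Q (f x) (f y)

record H (P Q : Pos) : Set where
  constructor hom
  field
    fn   : C P → C Q
    mono : Monotone P Q fn
open H public

αraw : (P Q : Pos) → (C P → C Q) → C P → Triple Q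
αraw P Q ξ x = ⟨ ξ x , img ξ (Down P (G P ξ x)) , img ξ (Up P (G P ξ x)) ⟩

module _ {P Q : Pos} (ξ : H P Q) (x : C P) where
  private
    f = fn ξ
    A : Sub P
    A z = f z ≡ f x
    module P = IsPartialOrder (Pos.isPartialOrder P)
    module Q = IsPartialOrder (Pos.isPartialOrder Q)

  αraw-dn : ∀ q → dn (αraw P Q f x) q → Down Q (sing {Q} (f x)) q
  αraw-dn q (y , ((g , Gg , y≤g) , ¬Gy) , refl) =
    (f x , refl , subst (Le Q (f y)) (chain-end Gg) (mono ξ y≤g)) , λ e →
      ¬Gy (step Gg e (inj₂ (y≤g , λ y≡g → ¬Gy (subst (G P f x) (sym y≡g) Gg))))

  αraw-up : ∀ q → up (αraw P Q f x) q → Up Q (sing {Q} (f x)) q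
  αraw-up q (y , ((g , Gg , g≤y) , ¬Gy) , refl) =
    (f x , refl , subst (λ w → Le Q w (f y)) (chain-end Gg) (mono ξ g≤y)) , λ e →
      ¬Gy (step Gg e (inj₁ (g≤y , λ g≡y → ¬Gy (subst (G P f x) g≡y Gg))))

α : {P Q : Pos} → H P Q → C P → EV Q
α {P} {Q} ξ x = ev (αraw P Q (fn ξ) x) (αraw-dn ξ x , αraw-up ξ x)

HomScheme : Pos → Pos → Set₁
HomScheme R S = (P : FinPoset) → H (poset P) R → H (poset P) S

-- ρ_P is a map on 𝓗(P,R) (maps compared pointwise)
IsExtensional : {R S : Pos} → HomScheme R S → Set₁
IsExtensional ρ = ∀ P ξ ζ → (∀ z → fn ξ z ≡ fn ζ z) → ∀ z → fn (ρ P ξ) z ≡ fn (ρ P ζ) z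

IsStrong : {R S : Pos} → HomScheme R S → Set₁
IsStrong ρ = ∀ P ξ ζ → (∀ z → fn (ρ P ξ) z ≡ fn (ρ P ζ) z) → ∀ z → fn ξ z ≡ fn ζ z

IsIScheme : {R S : Pos} → HomScheme R S → Set₁
IsIScheme {R} ρ = ∀ (P P' : FinPoset) (ξ : H (poset P) R) (ζ : H (poset P') R) (x : C (poset P)) (y : C (poset P')) →
  ((α ξ x ≤+ α ζ y) → (α (ρ P ξ) x ≤+ α (ρ P' ζ) y))
  × ((α ξ x <+ α ζ y) → (α (ρ P ξ) x <+ α (ρ P' ζ) y))

_⊑I_ : Pos → Pos → Set₁
R ⊑I S = Σ (HomScheme R S) λ ρ → IsExtensional ρ × IsStrong ρ × IsIScheme ρ

module _ (Q R : Pos) where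
  Ysub : Sub (Q ⊕ R)
  Ysub w = ∃ λ y → w ≡ inj₁ y

  Xsub : Sub (Q ⊕ R)
  Xsub w = ∃ λ x → w ≡ inj₂ x

  starRaw : EV Q → Triple (Q ⊕ R)
  starRaw b = ⟨ inj₁ (fstE b) , img inj₁ (dn (tr b)) , (λ w → img inj₁ (up (tr b)) w ⊎ Xsub w) ⟩

  InStar : EV (Q ⊕ R) → Set₁
  InStar a = ∃ λ (b : EV Q) → tr a ≈T starRaw b

  rRaw : EV R → Triple (Q ⊕ R)
  rRaw a = ⟨ inj₂ (fstE a) , (λ w → img inj₂ (dn (tr a)) w ⊎ Ysub w) , img inj₂ (up (tr a)) ⟩

  r-dn : ∀ a w → dn (rRaw a) w → Down (Q ⊕ R) (sing {Q ⊕ R} (pt (rRaw a))) w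
  r-dn a w (inj₁ (d , Dd , refl)) with proj₁ (isEV a) d Dd
  ... | (_ , refl , d≤x) , d≢x = (_ , refl , ₂≤₂ d≤x) , λ e → d≢x (inj₂-inj e)
    where
      inj₂-inj : ∀ {u v : C R} → _≡_ {A = C Q ⊎ C R} (inj₂ u) (inj₂ v) → u ≡ v
      inj₂-inj refl = refl
  r-dn a w (inj₂ (y , refl)) = (_ , refl , ₁≤₂) , λ ()

  r-up : ∀ a w → up (rRaw a) w → Up (Q ⊕ R) (sing {Q ⊕ R} (pt (rRaw a))) w
  r-up a w (u , Uu , refl) with proj₂ (isEV a) u Uu
  ... | (_ , refl , x≤u) , u≢x = (_ , refl , ₂≤₂ x≤u) , λ e → u≢x (inj₂-inj e)
    where
      inj₂-inj : ∀ {u v : C R} → _≡_ {A = C Q ⊎ C R} (inj₂ u) (inj₂ v) → u ≡ v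
      inj₂-inj refl = refl

  r : EV R → EV (Q ⊕ R)
  r a = ev (rRaw a) (r-dn a , r-up a)

  sRaw : EV (Q ⊕ R) → Triple (Q ⊕ R)
  sRaw a = ⟨ fstE a , (λ w → dn (tr a) w × ¬ Ysub w) , up (tr a) ⟩

  -- the triple of 𝓔(R) viewed inside Q ⊕ R (identifying x ∈ R with inj₂ x)
  embedRaw : EV R → Triple (Q ⊕ R)
  embedRaw a = ⟨ inj₂ (fstE a) , img inj₂ (dn (tr a)) , img inj₂ (up (tr a)) ⟩

-- Each y ∈ Y is ε(𝔞)₁ for some 𝔞 ∈ 𝓔(Q)*, and 𝔞 <+ r(𝔠) for every 𝔠; since an
-- injective ≤+-homomorphism preserves <+, y lies in the down-set of every ε(r(𝔠)).
-- Triples on Q ⊕ S whose down-set contains Y are determined by their restriction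
-- to S, so T = s ∘ ε ∘ r inherits congruence, injectivity and <+-monotonicity
-- from ε and r.  For ξ : P → R apply the hypothesis on α to id ⊕ ξ : Q ⊕ P → Q ⊕ R.
-- The induced map η sends each x ∈ P to τ_P(ξ)(x) ∈ S, and every y ∈ Y is an
-- η-image (Y lies in the down-set of ε(r(α(x)))) necessarily of a point of Q;
-- Q being finite, η then maps Q into Q.  So the η-fibres through P are the
-- τ_P(ξ)-fibres, which gives α_{P,τ_P(ξ)} = T ∘ α_{P,ξ}.

module Submission where

open import Defs
open import Data.Nat using (ℕ; suc; _+_)
open import Data.Nat.Properties using (1+n≰n)
open import Data.Fin using (Fin; punchOut; _≟_)
open import Data.Fin.Properties using (punchOut-injective; injective⇒≤; +↔⊎)
open import Data.Sum using (_⊎_; inj₁; inj₂)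
import Data.Sum as Sum
open import Data.Sum.Properties using (inj₁-injective; inj₂-injective)
open import Data.Sum.Function.Propositional using (_⊎-↔_)
open import Data.Product using (Σ; ∃; _×_; _,_; proj₁; proj₂)
open import Data.Empty using (⊥-elim)
open import Level using (0ℓ)
open import Function using (_∘_; case_of_)
open import Function.Bundles using (_↔_; _⇔_; mk⇔; Inverse; Injection; Equivalence)
open import Function.Definitions using (Injective)
open import Function.Properties.Equivalence using (⇔-isEquivalence)
open import Function.Properties.Inverse using (↔-sym; ↔-trans; ↔⇒↣)
open import Relation.Nullary using (¬_; yes; no)
open import Relation.Nullary.Decidable using (map′)
open import Relation.Binary.Bundles using (Setoid)
open import Relation.Binary.Definitions using (DecidableEquality)
open import Relation.Binary.Structures using (IsEquivalence; IsPartialOrder)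
open import Relation.Binary.PropositionalEquality
  using (_≡_; _≢_; _≗_; refl; sym; trans; cong; subst)
import Relation.Binary.Reasoning.Setoid as SetoidReasoning

open Equivalence using (to; from)
open IsEquivalence (⇔-isEquivalence {ℓ = 0ℓ})
  using () renaming (refl to ⇔-refl; sym to ⇔-sym; trans to ⇔-trans)

img-inj₂ : {A B : Set} {X : B → Set} {s : B} → img (inj₂ {A = A}) X (inj₂ s) ⇔ X s
img-inj₂ = mk⇔ (λ { (_ , x , refl) → x }) (λ x → _ , x , refl)

module _ (A B : Pos) where

  Lt-inj₂ : ∀ {y z} → Lt B y z → Lt (A ⊕ B) (inj₂ y) (inj₂ z)
  Lt-inj₂ (y≤z , y≢z) = ₂≤₂ y≤z , y≢z ∘ inj₂-injective

  Lt-inj₂⁻ : ∀ {y z} → Lt (A ⊕ B) (inj₂ y) (inj₂ z) → Lt B y z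
  Lt-inj₂⁻ (₂≤₂ y≤z , y≢z) = y≤z , y≢z ∘ cong inj₂

≈T-refl : {P : Pos} {t : Triple P} → t ≈T t
≈T-refl = refl , (λ _ → ⇔-refl) , (λ _ → ⇔-refl)

≈T-sym : {P : Pos} {s t : Triple P} → s ≈T t → t ≈T s
≈T-sym (p , d , u) = sym p , (λ z → ⇔-sym (d z)) , (λ z → ⇔-sym (u z))

≈T-trans : {P : Pos} {s t w : Triple P} → s ≈T t → t ≈T w → s ≈T w
≈T-trans (p , d , u) (p' , d' , u') =
  trans p p' , (λ z → ⇔-trans (d z) (d' z)) , (λ z → ⇔-trans (u z) (u' z))

Triple-setoid : Pos → Setoid _ _
Triple-setoid P = record
  { Carrier       = Triple P
  ; _≈_           = _≈T_
  ; isEquivalence = record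
      { refl  = λ {t} → ≈T-refl {t = t}
      ; sym   = λ {s} {t} → ≈T-sym {s = s} {t}
      ; trans = λ {s} {t} {w} → ≈T-trans {s = s} {t} {w}
      }
  }

module _ {P : Pos} where

  dn⇒< : (a : EV P) {y : C P} → dn (tr a) y → Lt P y (fstE a)
  dn⇒< a d with proj₁ (isEV a) _ d
  ... | (_ , refl , y≤a) , y≢a = y≤a , y≢a

  up⇒> : (a : EV P) {y : C P} → up (tr a) y → Lt P (fstE a) y
  up⇒> a u with proj₂ (isEV a) _ u
  ... | (_ , refl , a≤y) , y≢a = a≤y , y≢a ∘ sym

  <⇒Down : {x y : C P} → Lt P y x → Down P (sing {P} x) y
  <⇒Down (y≤x , y≢x) = (_ , refl , y≤x) , y≢x

  >⇒Up : {x y : C P} → Lt P x y → Up P (sing {P} x) y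
  >⇒Up (x≤y , x≢y) = (_ , refl , x≤y) , x≢y ∘ sym

  <+⇒pt≢ : (a b : EV P) → a <+ b → fstE a ≢ fstE b
  <+⇒pt≢ a b (a∈Db , _) = proj₂ (dn⇒< b a∈Db)

  <+-resp-≈E : {a a' b b' : EV P} → a ≈E a' → b ≈E b' → a <+ b → a' <+ b'
  <+-resp-≈E {a} {a'} {b} {b'} (a≡a' , _ , Ua⇔Ua') (b≡b' , Db⇔Db' , _) (a∈Db , b∈Ua) =
    subst (dn (tr b')) a≡a' (to (Db⇔Db' _) a∈Db) , subst (up (tr a')) b≡b' (to (Ua⇔Ua' _) b∈Ua)

  ≤+-resp-≈E : {a a' b b' : EV P} → a ≈E a' → b ≈E b' → a ≤+ b → a' ≤+ b'
  ≤+-resp-≈E {a} {a'} {b} {b'} a≈a' b≈b' (inj₁ a<b) =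
    inj₁ (<+-resp-≈E {a = a} {a'} {b} {b'} a≈a' b≈b' a<b)
  ≤+-resp-≈E {a} {a'} {b} {b'} a≈a' b≈b' (inj₂ a≈b) = inj₂ (begin
    tr a'  ≈⟨ a≈a' ⟨
    tr a   ≈⟨ a≈b ⟩
    tr b   ≈⟨ b≈b' ⟩
    tr b'  ∎)
    where open SetoidReasoning (Triple-setoid P)

module _ {A B : Pos} (f : EV A → EV B) where

  ≈E-Congruent : Set₁
  ≈E-Congruent = ∀ a b → a ≈E b → f a ≈E f b

  ≈E-Injective : Set₁
  ≈E-Injective = ∀ a b → f a ≈E f b → a ≈E b

  <+-Monotone : Set₁
  <+-Monotone = ∀ a b → a <+ b → f a <+ f b

  ≤+-Monotone : Set₁
  ≤+-Monotone = ∀ a b → a ≤+ b → f a ≤+ f b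

  injective-≤+-monotone⇒<+-monotone : ≈E-Injective → ≤+-Monotone → <+-Monotone
  injective-≤+-monotone⇒<+-monotone f-inj f-mono a b a<b with f-mono a b (inj₁ a<b)
  ... | inj₁ fa<fb = fa<fb
  ... | inj₂ fa≈fb = ⊥-elim (<+⇒pt≢ a b a<b (proj₁ (f-inj a b fa≈fb)))

  congruent-<+-monotone⇒≤+-monotone : ≈E-Congruent → <+-Monotone → ≤+-Monotone
  congruent-<+-monotone⇒≤+-monotone f-cong f-mono a b = Sum.map (f-mono a b) (f-cong a b)

module _ {P : Pos} where

  chain-map : {A B : Sub P} {x y : C P} → (∀ u → A u → B u) → Chain P A x y → Chain P B x y
  chain-map A⊆B (here a)       = here (A⊆B _ a)
  chain-map A⊆B (step c a y~z) = step (chain-map A⊆B c) (A⊆B _ a) y~z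

  chain-++ : {A : Sub P} {x y z : C P} → Chain P A x y → Chain P A y z → Chain P A x z
  chain-++ c (here _)       = c
  chain-++ c (step d a y~z) = step (chain-++ c d) a y~z

  chain-reverse : {A : Sub P} {x y : C P} → Chain P A x y → Chain P A y x
  chain-reverse (here a)       = here a
  chain-reverse (step c a y~z) = chain-++ (step (here a) (chain-end c) (Sum.swap y~z)) (chain-reverse c)

  module _ {B : Set} (f : C P → B) where

    G-sym : {z w : C P} → G P f z w → G P f w z
    G-sym c = chain-map (λ _ e → trans e (sym (chain-end c))) (chain-reverse c)

    G-trans : {z w u : C P} → G P f z w → G P f w u → G P f z u
    G-trans c d = chain-++ c (chain-map (λ _ e → trans e (chain-end c)) d)

    G-shift : {z w : C P} → G P f z w → ∀ u → G P f z u ⇔ G P f w u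
    G-shift c _ = mk⇔ (G-trans (G-sym c)) (G-trans c)

    ≤⇒G : DecidableEquality (C P) → {z w : C P} → Le P z w → f z ≡ f w → G P f z w
    ≤⇒G _≟P_ {z} {w} z≤w fz≡fw with z ≟P w
    ... | yes refl = here refl
    ... | no z≢w   = step (here refl) (sym fz≡fw) (inj₁ (z≤w , z≢w))

img-mono : {X Y : Set} {f f' : X → Y} {A B : X → Set} →
           f ≗ f' → (∀ u → A u → B u) → ∀ q → img f A q → img f' B q
img-mono f≗f' A⊆B q (y , Ay , fy≡q) = y , A⊆B y Ay , trans (sym (f≗f' y)) fy≡q

module _ (P : Pos) {A B : Sub P} (A⇔B : ∀ u → A u ⇔ B u) where

  Down-resp-⇔ : ∀ y → Down P A y → Down P B y
  Down-resp-⇔ y ((a , Aa , y≤a) , ¬Ay) = (a , to (A⇔B a) Aa , y≤a) , ¬Ay ∘ from (A⇔B y)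

  Up-resp-⇔ : ∀ y → Up P A y → Up P B y
  Up-resp-⇔ y ((a , Aa , a≤y) , ¬Ay) = (a , to (A⇔B a) Aa , a≤y) , ¬Ay ∘ from (A⇔B y)

module _ (P Q : Pos) {f f' : C P → C Q} where

  αraw-cong : {x x' : C P} → f ≗ f' → f x ≡ f' x' → (∀ u → G P f x u ⇔ G P f' x' u) →
              αraw P Q f x ≈T αraw P Q f' x'
  αraw-cong f≗f' fx≡f'x' G⇔G' = fx≡f'x'
    , (λ q → mk⇔ (img-mono f≗f' (Down-resp-⇔ P G⇔G') q)
                 (img-mono (sym ∘ f≗f') (Down-resp-⇔ P (⇔-sym ∘ G⇔G')) q))
    , (λ q → mk⇔ (img-mono f≗f' (Up-resp-⇔ P G⇔G') q)
                 (img-mono (sym ∘ f≗f') (Up-resp-⇔ P (⇔-sym ∘ G⇔G')) q))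

  αraw-pointwise : f ≗ f' → ∀ x → αraw P Q f x ≈T αraw P Q f' x
  αraw-pointwise f≗f' x = αraw-cong f≗f' (f≗f' x) λ _ →
    mk⇔ (chain-map (λ v e → trans (sym (f≗f' v)) (trans e (f≗f' x))))
        (chain-map (λ v e → trans (f≗f' v) (trans e (sym (f≗f' x)))))

αraw-component : (P Q : Pos) (f : C P → C Q) {z w : C P} → G P f z w → αraw P Q f z ≈T αraw P Q f w
αraw-component P Q f c = αraw-cong P Q (λ _ → refl) (sym (chain-end c)) (G-shift f c)

α-<+ : {P R : Pos} (ξ : H P R) {z w : C P} → Le P z w → fn ξ z ≢ fn ξ w → α ξ z <+ α ξ w
α-<+ ξ {z} {w} z≤w ξz≢ξw =
  (z , ((w , here refl , z≤w) , ξz≢ξw ∘ chain-end) , refl) ,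
  (w , ((z , here refl , z≤w) , ξz≢ξw ∘ sym ∘ chain-end) , refl)

τ : {P R S : Pos} → (EV R → EV S) → H P R → C P → C S
τ T ξ z = fstE (T (α ξ z))

τ-monotone : {P R S : Pos} → DecidableEquality (C P) → DecidableEquality (C R) →
             (T : EV R → EV S) → ≈E-Congruent T → <+-Monotone T →
             (ξ : H P R) → Monotone P S (τ T ξ)
τ-monotone {P} {R} {S} _≟P_ _≟R_ T T-cong T-<+ ξ {z} {w} z≤w with fn ξ z ≟R fn ξ w
... | yes ξz≡ξw = IsPartialOrder.reflexive (Pos.isPartialOrder S)
  (proj₁ (T-cong _ _ (αraw-component P R (fn ξ) (≤⇒G (fn ξ) _≟P_ z≤w ξz≡ξw))))
... | no ξz≢ξw = proj₁ (dn⇒< (T (α ξ w)) (proj₁ (T-<+ _ _ (α-<+ ξ z≤w ξz≢ξw))))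

module _ (A B : Pos) where

  -- On these triples, restriction to B is the paper's s, and r is its inverse.
  LeftInDn : EV (A ⊕ B) → Set
  LeftInDn a = ∀ q → dn (tr a) (inj₁ q)

  module _ (a : EV (A ⊕ B)) (left : LeftInDn a) where

    pt-inj₂ : ∃ λ p → fstE a ≡ inj₂ p
    pt-inj₂ with fstE a in eq
    ... | inj₁ q = ⊥-elim (proj₂ (dn⇒< a (left q)) (sym eq))
    ... | inj₂ p = p , refl

    ¬up-inj₁ : ∀ q → ¬ up (tr a) (inj₁ q)
    ¬up-inj₁ q u with subst (λ w → Le (A ⊕ B) w (inj₁ q)) (proj₂ pt-inj₂) (proj₁ (up⇒> a u))
    ... | ()

    restrict₂ : EV B
    restrict₂ = ev ⟨ proj₁ pt-inj₂ , (λ s → dn (tr a) (inj₂ s)) , (λ s → up (tr a) (inj₂ s)) ⟩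
                   (below , above)
      where
      below : ∀ s → dn (tr a) (inj₂ s) → Down B (sing {B} (proj₁ pt-inj₂)) s
      below s d = <⇒Down {B} (Lt-inj₂⁻ A B (subst (Lt (A ⊕ B) (inj₂ s)) (proj₂ pt-inj₂) (dn⇒< a d)))

      above : ∀ s → up (tr a) (inj₂ s) → Up B (sing {B} (proj₁ pt-inj₂)) s
      above s u = >⇒Up {B} (Lt-inj₂⁻ A B (subst (λ w → Lt (A ⊕ B) w (inj₂ s)) (proj₂ pt-inj₂) (up⇒> a u)))

  module _ (a b : EV (A ⊕ B)) (left-a : LeftInDn a) (left-b : LeftInDn b) where
    private
      pa = proj₂ (pt-inj₂ a left-a)
      pb = proj₂ (pt-inj₂ b left-b)

    restrict₂-cong : a ≈E b → restrict₂ a left-a ≈E restrict₂ b left-b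
    restrict₂-cong (a≡b , D⇔ , U⇔) = inj₂-injective (trans (sym pa) (trans a≡b pb)) , D⇔ ∘ inj₂ , U⇔ ∘ inj₂

    restrict₂-injective : restrict₂ a left-a ≈E restrict₂ b left-b → a ≈E b
    restrict₂-injective (p≡p' , D⇔ , U⇔) = trans pa (trans (cong inj₂ p≡p') (sym pb)) , dn⇔ , up⇔
      where
      dn⇔ : ∀ w → dn (tr a) w ⇔ dn (tr b) w
      dn⇔ (inj₁ q) = mk⇔ (λ _ → left-b q) (λ _ → left-a q)
      dn⇔ (inj₂ s) = D⇔ s

      up⇔ : ∀ w → up (tr a) w ⇔ up (tr b) w
      up⇔ (inj₁ q) = mk⇔ (⊥-elim ∘ ¬up-inj₁ a left-a q) (⊥-elim ∘ ¬up-inj₁ b left-b q)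
      up⇔ (inj₂ s) = U⇔ s

    restrict₂-<+ : a <+ b → restrict₂ a left-a <+ restrict₂ b left-b
    restrict₂-<+ (a∈Db , b∈Ua) = subst (dn (tr b)) pa a∈Db , subst (up (tr a)) pb b∈Ua

  embed-restrict₂ : ∀ a left → embedRaw A B (restrict₂ a left) ≈T sRaw A B a
  embed-restrict₂ a left = sym (proj₂ (pt-inj₂ a left)) , dn⇔ , up⇔
    where
    dn⇔ : ∀ w → img inj₂ (λ s → dn (tr a) (inj₂ s)) w ⇔ (dn (tr a) w × ¬ Ysub A B w)
    dn⇔ (inj₁ q) = mk⇔ (λ { (_ , _ , ()) }) (λ (_ , ¬Y) → ⊥-elim (¬Y (q , refl)))
    dn⇔ (inj₂ s) = mk⇔ (λ d → to img-inj₂ d , λ { (_ , ()) }) (from img-inj₂ ∘ proj₁)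

    up⇔ : ∀ w → img inj₂ (λ s → up (tr a) (inj₂ s)) w ⇔ up (tr a) w
    up⇔ (inj₁ q) = mk⇔ (λ { (_ , _ , ()) }) (⊥-elim ∘ ¬up-inj₁ a left q)
    up⇔ (inj₂ s) = img-inj₂

  r-left : ∀ c → LeftInDn (r A B c)
  r-left c q = inj₂ (q , refl)

  restrict₂-r : ∀ c → restrict₂ (r A B c) (r-left c) ≈E c
  restrict₂-r c = refl
    , (λ s → mk⇔ (λ { (inj₁ d) → to img-inj₂ d ; (inj₂ (_ , ())) }) (inj₁ ∘ from img-inj₂))
    , (λ s → img-inj₂)

  InStar⇒<+r : ∀ a → InStar A B a → ∀ c → a <+ r A B c
  InStar⇒<+r a (b , a≡b , _ , Ua⇔) c =
    subst (dn (tr (r A B c))) (sym a≡b) (inj₂ (fstE b , refl)) ,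
    from (Ua⇔ (inj₂ (fstE c))) (inj₂ (fstE c , refl))

  r-<+ : <+-Monotone (r A B)
  r-<+ a b (a∈Db , b∈Ua) = inj₁ (fstE a , a∈Db , refl) , (fstE b , b∈Ua , refl)

  private
    module R = SetoidReasoning (Triple-setoid B)

  r-cong : ≈E-Congruent (r A B)
  r-cong a b a≈b = restrict₂-injective (r A B a) (r A B b) (r-left a) (r-left b) (R.begin
    tr (restrict₂ (r A B a) (r-left a))  R.≈⟨ restrict₂-r a ⟩
    tr a                                 R.≈⟨ a≈b ⟩
    tr b                                 R.≈⟨ restrict₂-r b ⟨
    tr (restrict₂ (r A B b) (r-left b))  R.∎)

  r-injective : ≈E-Injective (r A B)
  r-injective a b ra≈rb = R.begin
    tr a                                 R.≈⟨ restrict₂-r a ⟨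
    tr (restrict₂ (r A B a) (r-left a))  R.≈⟨ restrict₂-cong (r A B a) (r A B b) (r-left a) (r-left b) ra≈rb ⟩
    tr (restrict₂ (r A B b) (r-left b))  R.≈⟨ restrict₂-r b ⟩
    tr b                                 R.∎

Fin-injective⇒¬avoids : ∀ {n} (f : Fin n → Fin n) → Injective _≡_ _≡_ f → ∀ i → ¬ (∀ k → i ≢ f k)
Fin-injective⇒¬avoids {suc m} f f-inj i avoids = 1+n≰n (injective⇒≤ g-inj)
  where
  g : Fin (suc m) → Fin m
  g k = punchOut (avoids k)

  g-inj : Injective _≡_ _≡_ g
  g-inj e = f-inj (punchOut-injective (avoids _) (avoids _) e)

injective⇒¬avoids : {A : Set} {n : ℕ} → A ↔ Fin n →
                    (h : A → A) → Injective _≡_ _≡_ h → ∀ a → ¬ (∀ x → a ≢ h x)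
injective⇒¬avoids A↔Fin h h-inj a avoids =
  Fin-injective⇒¬avoids (F.to ∘ h ∘ F.from) (from-inj ∘ h-inj ∘ to-inj) (F.to a)
                        (λ k → avoids (F.from k) ∘ to-inj)
  where
  module F = Inverse A↔Fin
  to-inj = Injection.injective (↔⇒↣ A↔Fin)
  from-inj = Injection.injective (↔⇒↣ (↔-sym A↔Fin))

left-onto⇒left-valued : {A B : Set} {n : ℕ} → A ↔ Fin n → (g : A → A ⊎ B) →
                        (∀ y → ∃ λ x → g x ≡ inj₁ y) → ∀ x → ∃ λ y → g x ≡ inj₁ y
left-onto⇒left-valued A↔Fin g onto x with g x in gx≡
... | inj₁ y = y , refl
... | inj₂ b = ⊥-elim (injective⇒¬avoids A↔Fin h h-inj x x≢h)
  where
  h = λ y → proj₁ (onto y)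

  h-inj : Injective _≡_ _≡_ h
  h-inj {y} {y'} e = inj₁-injective (trans (sym (proj₂ (onto y))) (trans (cong g e) (proj₂ (onto y'))))

  x≢h : ∀ y → x ≢ h y
  x≢h y x≡hy with trans (sym gx≡) (trans (cong g x≡hy) (proj₂ (onto y)))
  ... | ()

FinPoset-≟ : (P : FinPoset) → DecidableEquality (C (poset P))
FinPoset-≟ P a b = map′ (Injection.injective (↔⇒↣ (FinPoset.finite P))) (cong F.to) (F.to a ≟ F.to b)
  where module F = Inverse (FinPoset.finite P)

_⊕F_ : FinPoset → FinPoset → FinPoset
A ⊕F B = record
  { pos        = poset A ⊕ poset B
  ; size       = FinPoset.size A + FinPoset.size B
  ; finite     = ↔-trans (FinPoset.finite A ⊎-↔ FinPoset.finite B) (↔-sym +↔⊎)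
  ; inhabitant = inj₁ (FinPoset.inhabitant A)
  }

id⊕ : {Q P R : Pos} → H P R → H (Q ⊕ P) (Q ⊕ R)
id⊕ {Q} {P} {R} ξ = hom (Sum.map₂ (fn ξ)) monotone
  where
  monotone : Monotone (Q ⊕ P) (Q ⊕ R) (Sum.map₂ (fn ξ))
  monotone (₁≤₁ q≤q') = ₁≤₁ q≤q'
  monotone ₁≤₂        = ₁≤₂
  monotone (₂≤₂ z≤z') = ₂≤₂ (mono ξ z≤z')

module Fibre (Q Q' P R : Pos) (f : C P → C R) (g : C (Q ⊕ P) → C (Q' ⊕ R))
  (g-inj₂ : ∀ z → g (inj₂ z) ≡ inj₂ (f z))
  (g-inj₁ : ∀ q → ∃ λ q' → g (inj₁ q) ≡ inj₁ q')
  (x : C P) where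

  private
    Gx : Sub P
    Gx = G P f x

    Gx⁺ : Sub (Q ⊕ P)
    Gx⁺ = G (Q ⊕ P) g (inj₂ x)

  g-inj₁≢inj₂ : ∀ q s → g (inj₁ q) ≢ inj₂ s
  g-inj₁≢inj₂ q s e with trans (sym (proj₂ (g-inj₁ q))) e
  ... | ()

  same-fibre : ∀ z → g (inj₂ z) ≡ g (inj₂ x) ⇔ f z ≡ f x
  same-fibre z = mk⇔ (λ e → inj₂-injective (trans (sym (g-inj₂ z)) (trans e (g-inj₂ x))))
                     (λ e → trans (g-inj₂ z) (trans (cong inj₂ e) (sym (g-inj₂ x))))

  lift : ∀ {z} → Gx z → Gx⁺ (inj₂ z)
  lift (here _)       = here refl
  lift (step c e y~z) = step (lift c) (from (same-fibre _) e) (Sum.map (Lt-inj₂ Q P) (Lt-inj₂ Q P) y~z)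

  lower : ∀ {v} → Gx⁺ v → ∃ λ z → v ≡ inj₂ z × Gx z
  lower (here _) = x , refl , here refl
  lower {inj₁ q} (step c e _) = ⊥-elim (g-inj₁≢inj₂ q (f x) (trans e (g-inj₂ x)))
  lower {inj₂ z} (step c e y~z) with lower c
  ... | y , refl , c' = z , refl , step c' (to (same-fibre z) e) (Sum.map (Lt-inj₂⁻ Q P) (Lt-inj₂⁻ Q P) y~z)

  G-inj₂ : ∀ z → Gx⁺ (inj₂ z) ⇔ Gx z
  G-inj₂ z = mk⇔ (λ c → case lower c of λ { (_ , refl , c') → c' }) lift

  Down-inj₂ : ∀ z → Down (Q ⊕ P) Gx⁺ (inj₂ z) ⇔ Down P Gx z
  Down-inj₂ z = mk⇔ fwd bwd
    where
    fwd : Down (Q ⊕ P) Gx⁺ (inj₂ z) → Down P Gx z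
    fwd ((a , Ga , z≤a) , ¬Gz) with lower Ga | z≤a
    ... | a' , refl , c | ₂≤₂ z≤a' = (a' , c , z≤a') , ¬Gz ∘ lift

    bwd : Down P Gx z → Down (Q ⊕ P) Gx⁺ (inj₂ z)
    bwd ((a , Ga , z≤a) , ¬Gz) = (inj₂ a , lift Ga , ₂≤₂ z≤a) , ¬Gz ∘ to (G-inj₂ z)

  Up-inj₂ : ∀ z → Up (Q ⊕ P) Gx⁺ (inj₂ z) ⇔ Up P Gx z
  Up-inj₂ z = mk⇔ fwd bwd
    where
    fwd : Up (Q ⊕ P) Gx⁺ (inj₂ z) → Up P Gx z
    fwd ((a , Ga , a≤z) , ¬Gz) with lower Ga | a≤z
    ... | a' , refl , c | ₂≤₂ a'≤z = (a' , c , a'≤z) , ¬Gz ∘ lift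

    bwd : Up P Gx z → Up (Q ⊕ P) Gx⁺ (inj₂ z)
    bwd ((a , Ga , a≤z) , ¬Gz) = (inj₂ a , lift Ga , ₂≤₂ a≤z) , ¬Gz ∘ to (G-inj₂ z)

  img-inj₂⇔ : {A⁺ : Sub (Q ⊕ P)} {A : Sub P} → (∀ z → A⁺ (inj₂ z) ⇔ A z) →
              ∀ s → img g A⁺ (inj₂ s) ⇔ img f A s
  img-inj₂⇔ {A⁺} {A} A⁺⇔A s = mk⇔ fwd bwd
    where
    fwd : img g A⁺ (inj₂ s) → img f A s
    fwd (inj₁ q , _ , e) = ⊥-elim (g-inj₁≢inj₂ q s e)
    fwd (inj₂ z , a , e) = z , to (A⁺⇔A z) a , inj₂-injective (trans (sym (g-inj₂ z)) e)

    bwd : img f A s → img g A⁺ (inj₂ s)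
    bwd (z , a , e) = inj₂ z , from (A⁺⇔A z) a , trans (g-inj₂ z) (cong inj₂ e)

  dn-inj₁ : ∀ q → dn (αraw (Q ⊕ P) (Q' ⊕ R) g (inj₂ x)) (g (inj₁ q))
  dn-inj₁ q = inj₁ q , ((inj₂ x , here refl , ₁≤₂) , ¬G) , refl
    where
    ¬G : ¬ Gx⁺ (inj₁ q)
    ¬G c = g-inj₁≢inj₂ q (f x) (trans (chain-end c) (g-inj₂ x))

  dn-inj₂ : ∀ s → dn (αraw (Q ⊕ P) (Q' ⊕ R) g (inj₂ x)) (inj₂ s) ⇔ dn (αraw P R f x) s
  dn-inj₂ = img-inj₂⇔ Down-inj₂

  up-inj₂ : ∀ s → up (αraw (Q ⊕ P) (Q' ⊕ R) g (inj₂ x)) (inj₂ s) ⇔ up (αraw P R f x) s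
  up-inj₂ = img-inj₂⇔ Up-inj₂

AlphaCompatible : {R S : Pos} → (EV R → EV S) → Set₁
AlphaCompatible {R} {S} T =
  ∀ (P : FinPoset) (ξ : H (poset P) R) x → αraw (poset P) S (τ T ξ) x ≈T tr (T (α ξ x))

⊑I-by-EV-map : {R S : Pos} → DecidableEquality (C R) → (T : EV R → EV S) →
               ≈E-Congruent T → ≈E-Injective T → <+-Monotone T → AlphaCompatible T → R ⊑I S
⊑I-by-EV-map {R} {S} _≟R_ T T-cong T-inj T-<+ T-α = ρ , ρ-ext , ρ-strong , ρ-I
  where
  open SetoidReasoning (Triple-setoid S)

  ρ : HomScheme R S
  ρ P ξ = hom (τ T ξ) (τ-monotone (FinPoset-≟ P) _≟R_ T T-cong T-<+ ξ)

  T≈αρ : ∀ P ξ x → T (α ξ x) ≈E α (ρ P ξ) x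
  T≈αρ P ξ x = ≈T-sym {s = αraw (poset P) S (τ T ξ) x} {t = tr (T (α ξ x))} (T-α P ξ x)

  ρ-ext : IsExtensional ρ
  ρ-ext P ξ ζ ξ≗ζ z = proj₁ (T-cong _ _ (αraw-pointwise (poset P) R ξ≗ζ z))

  ρ-strong : IsStrong ρ
  ρ-strong P ξ ζ ρξ≗ρζ z = proj₁ (T-inj _ _ (begin
    tr (T (α ξ z))              ≈⟨ T-α P ξ z ⟨
    αraw (poset P) S (τ T ξ) z  ≈⟨ αraw-pointwise (poset P) S ρξ≗ρζ z ⟩
    αraw (poset P) S (τ T ζ) z  ≈⟨ T-α P ζ z ⟩
    tr (T (α ζ z))              ∎))

  ρ-I : IsIScheme ρ
  ρ-I P P' ξ ζ x y =
    (λ α≤α → ≤+-resp-≈E {a = T (α ξ x)} {α (ρ P ξ) x} {T (α ζ y)} {α (ρ P' ζ) y}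
               (T≈αρ P ξ x) (T≈αρ P' ζ y) (congruent-<+-monotone⇒≤+-monotone T T-cong T-<+ _ _ α≤α)) ,
    (λ α<α → <+-resp-≈E {a = T (α ξ x)} {α (ρ P ξ) x} {T (α ζ y)} {α (ρ P' ζ) y}
               (T≈αρ P ξ x) (T≈αρ P' ζ y) (T-<+ _ _ α<α))

module Construction (Q R S : FinPoset)
  (ε : EV (poset Q ⊕ poset R) → EV (poset Q ⊕ poset S))
  (ε-cong : ≈E-Congruent ε) (ε-inj : ≈E-Injective ε) (ε-≤+ : ≤+-Monotone ε)
  (ε-α : ∀ (P : FinPoset) (ξ : H (poset P) (poset Q ⊕ poset R)) (x : C (poset P)) →
         αraw (poset P) (poset Q ⊕ poset S) (λ z → fstE (ε (α ξ z))) x ≈T tr (ε (α ξ x)))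
  (cover : ∀ y → ∃ λ a → InStar (poset Q) (poset R) a × fstE (ε a) ≡ inj₁ y)
  where

  private
    Qp = poset Q
    Rp = poset R
    Sp = poset S

  ε-<+ : <+-Monotone ε
  ε-<+ = injective-≤+-monotone⇒<+-monotone ε ε-inj ε-≤+

  εr : EV Rp → EV (Qp ⊕ Sp)
  εr c = ε (r Qp Rp c)

  ε-r-left : ∀ c → LeftInDn Qp Sp (εr c)
  ε-r-left c y with cover y
  ... | a , a∈Q* , εa≡y =
    subst (dn (tr (εr c))) εa≡y (proj₁ (ε-<+ a (r Qp Rp c) (InStar⇒<+r Qp Rp a a∈Q* c)))

  T : EV Rp → EV Sp
  T c = restrict₂ Qp Sp (εr c) (ε-r-left c)

  module _ (a b : EV Rp) where

    T-cong : a ≈E b → T a ≈E T b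
    T-cong a≈b = restrict₂-cong Qp Sp (εr a) (εr b) (ε-r-left a) (ε-r-left b)
      (ε-cong (r Qp Rp a) (r Qp Rp b) (r-cong Qp Rp a b a≈b))

    T-injective : T a ≈E T b → a ≈E b
    T-injective Ta≈Tb = r-injective Qp Rp a b (ε-inj (r Qp Rp a) (r Qp Rp b)
      (restrict₂-injective Qp Sp (εr a) (εr b) (ε-r-left a) (ε-r-left b) Ta≈Tb))

    T-<+ : a <+ b → T a <+ T b
    T-<+ a<b = restrict₂-<+ Qp Sp (εr a) (εr b) (ε-r-left a) (ε-r-left b)
      (ε-<+ (r Qp Rp a) (r Qp Rp b) (r-<+ Qp Rp a b a<b))

  T-embed : ∀ a → embedRaw Qp Sp (T a) ≈T sRaw Qp Sp (εr a)
  T-embed a = embed-restrict₂ Qp Sp (εr a) (ε-r-left a)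

  module _ (P : FinPoset) (ξ : H (poset P) Rp) where
    private
      Pp = poset P

      ξ⁺ : H (poset (Q ⊕F P)) (Qp ⊕ Rp)
      ξ⁺ = id⊕ ξ

      η : C (Qp ⊕ Pp) → C (Qp ⊕ Sp)
      η v = fstE (ε (α ξ⁺ v))

      module ξ-fibre = Fibre Qp Qp Pp Rp (fn ξ) (fn ξ⁺) (λ _ → refl) (λ q → q , refl)

      α-ξ⁺≈r : ∀ x → α ξ⁺ (inj₂ x) ≈E r Qp Rp (α ξ x)
      α-ξ⁺≈r x = restrict₂-injective Qp Rp (α ξ⁺ (inj₂ x)) (r Qp Rp (α ξ x))
                                     (ξ-fibre.dn-inj₁ x) (r-left Qp Rp (α ξ x)) (begin
        tr (restrict₂ Qp Rp (α ξ⁺ (inj₂ x)) (ξ-fibre.dn-inj₁ x))       ≈⟨ refl , ξ-fibre.dn-inj₂ x , ξ-fibre.up-inj₂ x ⟩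
        tr (α ξ x)                                                      ≈⟨ restrict₂-r Qp Rp (α ξ x) ⟨
        tr (restrict₂ Qp Rp (r Qp Rp (α ξ x)) (r-left Qp Rp (α ξ x)))  ∎)
        where open SetoidReasoning (Triple-setoid Rp)

      η≈εr : ∀ x → αraw (Qp ⊕ Pp) (Qp ⊕ Sp) η (inj₂ x) ≈T tr (εr (α ξ x))
      η≈εr x = begin
        αraw (Qp ⊕ Pp) (Qp ⊕ Sp) η (inj₂ x)  ≈⟨ ε-α (Q ⊕F P) ξ⁺ (inj₂ x) ⟩
        tr (ε (α ξ⁺ (inj₂ x)))               ≈⟨ ε-cong (α ξ⁺ (inj₂ x)) (r Qp Rp (α ξ x)) (α-ξ⁺≈r x) ⟩
        tr (εr (α ξ x))                      ∎
        where open SetoidReasoning (Triple-setoid (Qp ⊕ Sp))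

      η-inj₂ : ∀ z → η (inj₂ z) ≡ inj₂ (τ T ξ z)
      η-inj₂ z = trans (proj₁ (ε-cong (α ξ⁺ (inj₂ z)) (r Qp Rp (α ξ z)) (α-ξ⁺≈r z)))
                       (proj₂ (pt-inj₂ Qp Sp (εr (α ξ z)) (ε-r-left (α ξ z))))

      η-onto-Q : ∀ y → ∃ λ q → η (inj₁ q) ≡ inj₁ y
      η-onto-Q y with from (proj₁ (proj₂ (η≈εr x₀)) (inj₁ y)) (ε-r-left (α ξ x₀) y)
        where x₀ = FinPoset.inhabitant P
      ... | inj₁ q , _ , ηq≡y = q , ηq≡y
      ... | inj₂ z , _ , ηz≡y with trans (sym (η-inj₂ z)) ηz≡y
      ...   | ()

      η-inj₁ : ∀ q → ∃ λ q' → η (inj₁ q) ≡ inj₁ q'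
      η-inj₁ = left-onto⇒left-valued (FinPoset.finite Q) (η ∘ inj₁) η-onto-Q

    T-α : ∀ x → αraw Pp Sp (τ T ξ) x ≈T tr (T (α ξ x))
    T-α x = refl
      , (λ s → ⇔-trans (⇔-sym (dn-inj₂ s)) (proj₁ (proj₂ (η≈εr x)) (inj₂ s)))
      , (λ s → ⇔-trans (⇔-sym (up-inj₂ s)) (proj₂ (proj₂ (η≈εr x)) (inj₂ s)))
      where open Fibre Qp Qp Pp Sp (τ T ξ) η η-inj₂ η-inj₁ x

theorem6 : (Q R S : FinPoset)
    (ε : EV ((poset Q) ⊕ (poset R)) → EV ((poset Q) ⊕ (poset S))) →
    -- ε is a well-defined map (respects equality of triples)
    (∀ a b → a ≈E b → ε a ≈E ε b) →
    -- ε is injective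
    (∀ a b → ε a ≈E ε b → a ≈E b) →
    -- ε is a homomorphism w.r.t. ≤₊
    (∀ a b → a ≤+ b → ε a ≤+ ε b) →
    -- α_{P,η(ξ)}(x) = ε(α_{P,ξ}(x)),  η(ξ)(z) = ε(α_{P,ξ}(z))₁
    (∀ (P : FinPoset) (ξ : H (poset P) ((poset Q) ⊕ (poset R))) (x : C (poset P)) →
       αraw (poset P) ((poset Q) ⊕ (poset S)) (λ z → fstE (ε (α ξ z))) x ≈T tr (ε (α ξ x))) →
    -- Y ⊆ { ε(𝔞)₁ : 𝔞 ∈ 𝓔(Q)* }
    (∀ (y : C (poset Q)) → ∃ λ (a : EV ((poset Q) ⊕ (poset R))) → InStar (poset Q) (poset R) a × fstE (ε a) ≡ inj₁ y) →
    -- conclusion: R ⊑_I S, and more precisely T = s ∘ ε ∘ r : 𝓔(R) → 𝓔(S) ...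
    ((poset R) ⊑I (poset S))
    × Σ (EV (poset R) → EV (poset S)) (λ T →
        -- T is s ∘ ε ∘ r
        (∀ a → embedRaw (poset Q) (poset S) (T a) ≈T sRaw (poset Q) (poset S) (ε (r (poset Q) (poset R) a)))
        -- T is injective
        × (∀ a b → T a ≈E T b → a ≈E b)
        -- T is a homomorphism
        × (∀ a b → a ≤+ b → T a ≤+ T b)
        -- τ_P(ξ)(z) := T(α_{P,ξ}(z))₁ is order preserving and α_{P,τ_P(ξ)}(x) = T(α_{P,ξ}(x))
        × (∀ (P : FinPoset) (ξ : H (poset P) (poset R)) →
             Σ (Monotone (poset P) (poset S) (λ z → fstE (T (α ξ z)))) (λ m →
               ∀ (x : C (poset P)) → α {poset P} {poset S} (hom (λ z → fstE (T (α ξ z))) m) x ≈E T (α ξ x))))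
theorem6 Q R S ε ε-cong ε-inj ε-≤+ ε-α cover =
  ⊑I-by-EV-map (FinPoset-≟ R) T T-cong T-injective T-<+ T-α ,
  T , T-embed , T-injective , congruent-<+-monotone⇒≤+-monotone T T-cong T-<+ ,
  λ P ξ → τ-monotone (FinPoset-≟ P) (FinPoset-≟ R) T T-cong T-<+ ξ , T-α P ξ
  where open Construction Q R S ε ε-cong ε-inj ε-≤+ ε-α cover
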